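{- Let $D=(V,A)$ be an acyclic digraph and let $F\subseteq V$. Then every convex set of $D$ containing $F$ is output exactly once by the procedure $\mathrm{CS}(D,F)$ (described in the context).
   Context: A set $X$ of vertices of an acyclic digraph $D$ is convex if $X\neq\emptyset$ and there is no directed path between two vertices of $X$ containing a vertex not in $X$. A vertex is a source (sink) if it has no in-neighbours (out-neighbours). For a vertex $s$, $D-s$ is the digraph obtained by deleting $s$. Procedure $\mathrm{CS}(D=(V,A),F)$: (1) output $V$; (2) for each vertex $s\in V\setminus F$ that is a source or sink of $D$, in turn: call $\mathrm{CS}(D-s,F)$, and then set $F:=F\cup\{s\}$ (so later recursive calls in this loop use the enlarged $F$). -}

module Defs where

open import Data.Nat using (ℕ; zero; suc)
open import Data.Bool using (Bool; true; false; not; _∧_; _∨_; if_then_else_)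
open import Data.Fin using (Fin)
open import Data.Fin.Subset using (Subset; _∈_; _⊆_; Nonempty; ⊤; _∪_; ⁅_⁆; _-_)
open import Data.List using (List; []; _∷_; _++_; allFin)
open import Data.Product using (_×_)
open import Data.List.Relation.Unary.All using (All)
open import Data.Vec using (lookup)
open import Data.Vec.Properties using (≡-dec)
import Data.Bool.Properties as BoolP
open import Relation.Nullary using (¬_; yes; no)
open import Relation.Binary.PropositionalEquality using (_≡_)

allB : {A : Set} → (A → Bool) → List A → Bool
allB p []       = true
allB p (x ∷ xs) = p x ∧ allB p xs

Digraph : ℕ → Set
Digraph n = Fin n → Fin n → Bool

module _ {n : ℕ} (arc : Digraph n) where

  data Path (W : Subset n) : Fin n → Fin n → List (Fin n) → Set where
    single : ∀ {x} → x ∈ W → Path W x x (x ∷ [])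
    step   : ∀ {x y z vs} → x ∈ W → arc x y ≡ true → Path W y z vs →
             Path W x z (x ∷ vs)

  Acyclic : Set
  Acyclic = ∀ x y vs → arc x y ≡ true → ¬ Path ⊤ y x vs

  Convex : Subset n → Subset n → Set
  Convex W X = X ⊆ W × Nonempty X ×
    (∀ x y vs → x ∈ X → y ∈ X → Path W x y vs → All (_∈ X) vs)

  isSource isSink : Subset n → Fin n → Bool
  isSource W s = allB (λ u → not (lookup W u ∧ arc u s)) (allFin n)
  isSink   W s = allB (λ u → not (lookup W u ∧ arc s u)) (allFin n)

  -- The natural-number argument is fuel bounding
  -- the recursion depth; each recursive call deletes a vertex, so fuel n
  -- (the number of vertices of D) never runs out before W becomes empty
  -- (and for empty W the loop produces nothing, matching CS zero).
  mutual
    CS : ℕ → Subset n → Subset n → List (Subset n)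
    CS zero    W F = W ∷ []
    CS (suc k) W F = W ∷ loop k W F (allFin n)

    loop : ℕ → Subset n → Subset n → List (Fin n) → List (Subset n)
    loop k W F []       = []
    loop k W F (s ∷ ss) =
      if lookup W s ∧ not (lookup F s) ∧ (isSource W s ∨ isSink W s)
      then CS k (W - s) F ++ loop k W (F ∪ ⁅ s ⁆) ss
      else loop k W F ss

occurrences : ∀ {n} → Subset n → List (Subset n) → ℕ
occurrences X []       = zero
occurrences X (Y ∷ Ys) with ≡-dec BoolP._≟_ X Y
... | yes _ = suc (occurrences X Ys)
... | no  _ = occurrences X Ys

-- Every set output by CS(W, F) lies between W ∩ F and W, and a set output by
-- the loop misses the vertex whose deletion produced it; so W is output once,
-- and no set missing a vertex of W ∩ F is output at all.  If X ≠ W is convex in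
-- D[W], then D[W] has a source or sink outside X: climb from some v ∈ W ∖ X to a
-- source s and descend from v to a sink t; if s and t were both in X, the path
-- s ⇝ v ⇝ t would contradict convexity.  In the loop, a deletable s ∈ X yields
-- nothing (X ⊄ W − s) and is frozen into F ⊆ X, while the first deletable s ∉ X,
-- reached at the latest at that source or sink, yields X exactly once by
-- induction, since X is still convex in D[W − s]; from then on s is frozen, so
-- the remaining calls output only sets containing s.

module Submission where

open import Defs
open import Data.Nat using (ℕ; zero; suc; _+_; _≤_; _<_; s≤s)
open import Data.Nat.Properties using (≤-pred; <-≤-trans; n≮0)
open import Data.Bool using (Bool; true; false; not; _∧_; _∨_)
open import Data.Bool.Properties using (∨-zeroʳ) renaming (_≟_ to _≟ᵇ_)
open import Data.Fin using (Fin)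
open import Data.Fin.Properties using (any?; _≟_)
open import Data.Fin.Subset using (Subset; _⊆_; ⊤; _∈_; _∉_; _─_; _∩_; _∪_; ⁅_⁆; _-_; ∣_∣)
open import Data.Fin.Subset.Properties
open import Data.List using ([]; _∷_; _++_; allFin)
open import Data.List.Membership.Propositional using () renaming (_∈_ to _∈ₗ_)
open import Data.List.Membership.Propositional.Properties using (∈-allFin)
open import Data.List.Relation.Unary.All as All using (All; []; _∷_)
open import Data.List.Relation.Unary.All.Properties using (++⁺)
open import Data.List.Relation.Unary.Any using (here; there)
open import Data.Vec as Vec using (lookup; _∷_)
open import Data.Vec.Properties using (≡-dec; []=⇒lookup; lookup⇒[]=)
open import Data.Product using (∃; _×_; _,_; proj₁; proj₂)
open import Data.Sum using (_⊎_; inj₁; inj₂)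
open import Data.Empty using (⊥-elim)
open import Function using (flip)
open import Relation.Nullary using (¬_; yes; no; ¬?; _×-dec_)
open import Relation.Nullary.Decidable using (decidable-stable)
open import Relation.Binary.PropositionalEquality using (_≡_; _≢_; refl; sym; trans; cong; cong₂; subst)

occurrences-∷-≡ : ∀ {n} (X : Subset n) L → occurrences X (X ∷ L) ≡ suc (occurrences X L)
occurrences-∷-≡ X L with ≡-dec _≟ᵇ_ X X
... | yes _  = refl
... | no X≢X = ⊥-elim (X≢X refl)

occurrences-∷-≢ : ∀ {n} {X Y : Subset n} L → X ≢ Y → occurrences X (Y ∷ L) ≡ occurrences X L
occurrences-∷-≢ {X = X} {Y} L X≢Y with ≡-dec _≟ᵇ_ X Y
... | yes X≡Y = ⊥-elim (X≢Y X≡Y)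
... | no _    = refl

occurrences-++ : ∀ {n} (X : Subset n) L M →
                 occurrences X (L ++ M) ≡ occurrences X L + occurrences X M
occurrences-++ X []      M = refl
occurrences-++ X (Y ∷ L) M with ≡-dec _≟ᵇ_ X Y
... | yes _ = cong suc (occurrences-++ X L M)
... | no _  = occurrences-++ X L M

occurrences-absent : ∀ {n} {X : Subset n} {L} → All (X ≢_) L → occurrences X L ≡ 0
occurrences-absent []                   = refl
occurrences-absent {L = Y ∷ L} (X≢Y ∷ ps) =
  trans (occurrences-∷-≢ L X≢Y) (occurrences-absent ps)

⊆⇒≡⊎∃∉ : ∀ {n} {X W : Subset n} → X ⊆ W → X ≡ W ⊎ ∃ λ v → v ∈ W × v ∉ X
⊆⇒≡⊎∃∉ {X = X} {W} X⊆W with any? (λ v → v ∈? W ×-dec ¬? (v ∈? X))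
... | yes witness = inj₂ witness
... | no none     = inj₁ (⊆-antisym X⊆W λ {v} v∈W →
                            decidable-stable (v ∈? X) λ v∉X → none (v , v∈W , v∉X))

x∈p─q⇒x∉q : ∀ {n} (p q : Subset n) {x} → x ∈ p ─ q → x ∉ q
x∈p─q⇒x∉q (_ ∷ p) (_ ∷ q)    (Vec.there x∈p─q) (Vec.there x∈q) = x∈p─q⇒x∉q p q x∈p─q x∈q
x∈p─q⇒x∉q (_ ∷ p) (true ∷ q) ()                Vec.here

x∉p-x : ∀ {n} (p : Subset n) x → x ∉ p - x
x∉p-x p x x∈p-x = x∈p─q⇒x∉q p ⁅ x ⁆ x∈p-x (x∈⁅x⁆ x)

∉⇒lookup≡false : ∀ {n} {x : Fin n} {p : Subset n} → x ∉ p → lookup p x ≡ false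
∉⇒lookup≡false {x = x} {p} x∉p with lookup p x in e
... | true  = ⊥-elim (x∉p (lookup⇒[]= x p e))
... | false = refl

allB-false⇒∃ : ∀ {A : Set} (p : A → Bool) xs → allB p xs ≡ false → ∃ λ x → p x ≡ false
allB-false⇒∃ p (x ∷ xs) e with p x in px
... | false = x , px
... | true  = allB-false⇒∃ p xs e

module Walks {n : ℕ} {arc : Digraph n} where

  path-mono : ∀ {W W' x y vs} → W ⊆ W' → Path arc W x y vs → Path arc W' x y vs
  path-mono W⊆W' (single x∈W)   = single (W⊆W' x∈W)
  path-mono W⊆W' (step x∈W a p) = step (W⊆W' x∈W) a (path-mono W⊆W' p)

  path-source : ∀ {W x y vs} → Path arc W x y vs → x ∈ W
  path-source (single x∈W)   = x∈W
  path-source (step x∈W _ _) = x∈W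

  path-target : ∀ {W x y vs} → Path arc W x y vs → y ∈ W
  path-target (single y∈W) = y∈W
  path-target (step _ _ p) = path-target p

  path-snoc : ∀ {W x y z vs} → Path arc W x y vs → arc y z ≡ true → z ∈ W →
              Path arc W x z (vs ++ z ∷ [])
  path-snoc (single x∈W)   a z∈W = step x∈W a (single z∈W)
  path-snoc (step x∈W b p) a z∈W = step x∈W b (path-snoc p a z∈W)

  path-join : ∀ {W x y z vs ws} → Path arc W x y vs → Path arc W y z ws →
              ∃ λ us → Path arc W x z us × y ∈ₗ us
  path-join (single _)     (single y∈W)   = _ , single y∈W , here refl
  path-join (single _)     (step y∈W a q) = _ , step y∈W a q , here refl
  path-join (step x∈W a p) q with path-join p q
  ... | _ , r , y∈us = _ , step x∈W a r , there y∈us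

  in-neighbour : ∀ W w → isSource arc W w ≡ false → ∃ λ u → u ∈ W × arc u w ≡ true
  in-neighbour W w e with allB-false⇒∃ _ (allFin n) e
  ... | u , eq with lookup W u in u∈W | arc u w in a
  ... | true | true = u , lookup⇒[]= u W u∈W , a

  reachable-via : ∀ {W R u w} → arc u w ≡ true → u ∈ W → (∀ y → y ∉ R → ∃ (Path arc W w y)) →
                  ∀ y → y ∉ R - u → ∃ (Path arc W u y)
  reachable-via {u = u} a u∈W reached y y∉R-u with y ≟ u
  ... | yes refl = _ , single u∈W
  ... | no y≢u   = _ , step u∈W a (proj₂ (reached y λ y∈R → y∉R-u (x∈p∧x≢y⇒x∈p-y y∈R y≢u)))

  -- By acyclicity an in-neighbour of w is not reachable from w, hence lies in R,
  -- so R shrinks at every step.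
  climb-to-source : Acyclic arc → ∀ k (R : Subset n) {W w} → ∣ R ∣ < k → w ∈ W →
                    (∀ y → y ∉ R → ∃ (Path arc W w y)) →
                    ∃ λ s → isSource arc W s ≡ true × ∃ (Path arc W s w)
  climb-to-source ac (suc k) R {W} {w} bd w∈W reached with isSource arc W w in src
  ... | true  = w , src , _ , single w∈W
  ... | false with in-neighbour W w src
  ... | u , u∈W , a with u ∈? R
  ... | no u∉R  = ⊥-elim (ac u w _ a (path-mono ⊆⊤ (proj₂ (reached u u∉R))))
  ... | yes u∈R with climb-to-source ac k (R - u) (<-≤-trans (x∈p⇒∣p-x∣<∣p∣ u∈R) (≤-pred bd)) u∈W
                                       (reachable-via a u∈W reached)
  ... | s , src' , _ , p = s , src' , _ , path-snoc p a w∈W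

  reached-from-source : Acyclic arc → ∀ {W w} → w ∈ W →
                    ∃ λ s → isSource arc W s ≡ true × ∃ (Path arc W s w)
  reached-from-source ac w∈W = climb-to-source ac (suc n) ⊤ (s≤s (∣p∣≤n ⊤)) w∈W
                             λ y y∉⊤ → ⊥-elim (y∉⊤ ∈⊤)

open Walks

path-reverse : ∀ {n} {arc : Digraph n} {W x y vs} → Path arc W x y vs → ∃ (Path (flip arc) W y x)
path-reverse (single x∈W) = _ , single x∈W
path-reverse (step x∈W a p) with path-reverse p
... | _ , q = _ , path-snoc q a x∈W

acyclic-flip : ∀ {n} {arc : Digraph n} → Acyclic arc → Acyclic (flip arc)
acyclic-flip ac x y vs a p = ac y x _ a (proj₂ (path-reverse p))

reaches-sink : ∀ {n} {arc : Digraph n} → Acyclic arc → ∀ {W w} → w ∈ W →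
               ∃ λ t → isSink arc W t ≡ true × ∃ (Path arc W w t)
reaches-sink ac w∈W with reached-from-source (acyclic-flip ac) w∈W
... | t , snk , _ , p = t , snk , path-reverse p

module Procedure {n : ℕ} (arc : Digraph n) where

  SourceOrSink : Subset n → Fin n → Set
  SourceOrSink W t = isSource arc W t ∨ isSink arc W t ≡ true

  -- the guard of the loop in CS, spelled out so that `with` can abstract it
  deletable : Subset n → Subset n → Fin n → Bool
  deletable W F s = lookup W s ∧ not (lookup F s) ∧ (isSource arc W s ∨ isSink arc W s)

  deletable⇒∈ : ∀ W F s → deletable W F s ≡ true → s ∈ W
  deletable⇒∈ W F s eq with lookup W s in s∈W
  ... | true = lookup⇒[]= s W s∈W

  deletable⇒∉ : ∀ W F s → deletable W F s ≡ true → s ∉ F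
  deletable⇒∉ W F s eq s∈F with lookup W s | lookup F s | []=⇒lookup s∈F
  deletable⇒∉ W F s () s∈F | true | true | refl

  deletable-intro : ∀ {W F s} → s ∈ W → s ∉ F → SourceOrSink W s → deletable W F s ≡ true
  deletable-intro s∈W s∉F st
    rewrite []=⇒lookup s∈W | ∉⇒lookup≡false s∉F | st = refl

  mutual
    CS-⊆ : ∀ k W F → All (_⊆ W) (CS arc k W F)
    CS-⊆ zero    W F = ⊆-refl ∷ []
    CS-⊆ (suc k) W F = ⊆-refl ∷ All.map proj₁ (loop-misses k W F (allFin n))

    loop-misses : ∀ k W F ss → All (λ Y → Y ⊆ W × ∃ λ s → s ∈ W × s ∉ Y) (loop arc k W F ss)
    loop-misses k W F []       = []
    loop-misses k W F (s ∷ ss) with deletable W F s in eq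
    ... | false = loop-misses k W F ss
    ... | true  = ++⁺ (All.map misses-s (CS-⊆ k (W - s) F)) (loop-misses k W (F ∪ ⁅ s ⁆) ss)
      where
        misses-s : ∀ {Y} → Y ⊆ W - s → Y ⊆ W × ∃ λ t → t ∈ W × t ∉ Y
        misses-s Y⊆W-s = ⊆-trans Y⊆W-s (p─q⊆p W ⁅ s ⁆) , s , deletable⇒∈ W F s eq ,
                         λ s∈Y → x∉p-x W s (Y⊆W-s s∈Y)

  mutual
    CS-⊇ : ∀ k W F → All (W ∩ F ⊆_) (CS arc k W F)
    CS-⊇ zero    W F = p∩q⊆p W F ∷ []
    CS-⊇ (suc k) W F = p∩q⊆p W F ∷ loop-⊇ k W F (allFin n)

    loop-⊇ : ∀ k W F ss → All (W ∩ F ⊆_) (loop arc k W F ss)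
    loop-⊇ k W F []       = []
    loop-⊇ k W F (s ∷ ss) with deletable W F s in eq
    ... | false = loop-⊇ k W F ss
    ... | true  = ++⁺ (All.map (⊆-trans W∩F⊆[W-s]∩F) (CS-⊇ k (W - s) F))
                      (All.map (⊆-trans W∩F⊆W∩[F∪s]) (loop-⊇ k W (F ∪ ⁅ s ⁆) ss))
      where
        W∩F⊆[W-s]∩F : W ∩ F ⊆ (W - s) ∩ F
        W∩F⊆[W-s]∩F x∈W∩F with x∈p∩q⁻ W F x∈W∩F
        ... | x∈W , x∈F =
          x∈p∩q⁺ (x∈p∧x≢y⇒x∈p-y x∈W (λ { refl → deletable⇒∉ W F s eq x∈F }) , x∈F)
        W∩F⊆W∩[F∪s] : W ∩ F ⊆ W ∩ (F ∪ ⁅ s ⁆)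
        W∩F⊆W∩[F∪s] x∈W∩F with x∈p∩q⁻ W F x∈W∩F
        ... | x∈W , x∈F = x∈p∩q⁺ (x∈W , x∈p∪q⁺ (inj₁ x∈F))

  occurrences-CS-⊈ : ∀ k W F {X} → ¬ X ⊆ W → occurrences X (CS arc k W F) ≡ 0
  occurrences-CS-⊈ k W F X⊈W =
    occurrences-absent (All.map (λ Y⊆W → λ { refl → X⊈W Y⊆W }) (CS-⊆ k W F))

  occurrences-loop-frozen : ∀ k W F ss {X s} → s ∈ W → s ∈ F → s ∉ X →
                            occurrences X (loop arc k W F ss) ≡ 0
  occurrences-loop-frozen k W F ss s∈W s∈F s∉X =
    occurrences-absent (All.map (λ W∩F⊆Y → λ { refl → s∉X (W∩F⊆Y (x∈p∩q⁺ (s∈W , s∈F))) })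
                                (loop-⊇ k W F ss))

  occurrences-CS-self : ∀ k W F → occurrences W (CS arc k W F) ≡ 1
  occurrences-CS-self zero    W F = occurrences-∷-≡ W []
  occurrences-CS-self (suc k) W F = trans (occurrences-∷-≡ W _) (cong suc
    (occurrences-absent (All.map (λ { (_ , s , s∈W , s∉Y) refl → s∉Y s∈W })
                                 (loop-misses k W F (allFin n)))))

  convex-delete : ∀ {W X s} → Convex arc W X → s ∉ X → Convex arc (W - s) X
  convex-delete {W} {s = s} (X⊆W , nonempty , closed) s∉X =
    (λ x∈X → x∈p∧x≢y⇒x∈p-y (X⊆W x∈X) λ { refl → s∉X x∈X }) , nonempty ,
    λ x y vs x∈X y∈X p → closed x y vs x∈X y∈X (path-mono (p─q⊆p W ⁅ s ⁆) p)

  source-or-sink-outside : Acyclic arc → ∀ {W X v} → Convex arc W X → v ∈ W → v ∉ X →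
                           ∃ λ t → t ∈ W × t ∉ X × SourceOrSink W t
  source-or-sink-outside ac {W} {X} (_ , _ , closed) v∈W v∉X
    with reached-from-source {arc = arc} ac v∈W | reaches-sink ac v∈W
  ... | s , src , _ , p | t , snk , _ , q with s ∈? X | t ∈? X
  ... | no s∉X | _      = s , path-source p , s∉X , cong (_∨ isSink arc W s) src
  ... | yes _  | no t∉X = t , path-target q , t∉X , trans (cong (isSource arc W t ∨_) snk) (∨-zeroʳ _)
  ... | yes s∈X | yes t∈X with path-join p q
  ... | _ , r , v∈r = ⊥-elim (v∉X (All.lookup (closed s t _ s∈X t∈X r) v∈r))

  ∪-⁅⁆-⊆ : ∀ {F X : Subset n} {s} → F ⊆ X → s ∈ X → F ∪ ⁅ s ⁆ ⊆ X
  ∪-⁅⁆-⊆ {F} {s = s} F⊆X s∈X x∈F∪s with x∈p∪q⁻ F ⁅ s ⁆ x∈F∪s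
  ... | inj₁ x∈F = F⊆X x∈F
  ... | inj₂ x∈s = subst (_∈ _) (sym (x∈⁅y⁆⇒x≡y s x∈s)) s∈X

  loop-once : ∀ k {W X t} → t ∈ W → t ∉ X → SourceOrSink W t →
              (ih : ∀ {F} s → s ∈ W → s ∉ X → F ⊆ X → occurrences X (CS arc k (W - s) F) ≡ 1) →
              ∀ ss F → t ∈ₗ ss → F ⊆ X → occurrences X (loop arc k W F ss) ≡ 1
  loop-once k {W} {X} t∈W t∉X st ih (s ∷ ss) F t∈s∷ss F⊆X with deletable W F s in eq | t∈s∷ss
  ... | false | here refl with () ← trans (sym eq) (deletable-intro t∈W (λ t∈F → t∉X (F⊆X t∈F)) st)
  ... | false | there t∈ss = loop-once k t∈W t∉X st ih ss F t∈ss F⊆X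
  ... | true  | t∈ with s ∈? X | t∈
  ...   | yes s∈X | here refl  = ⊥-elim (t∉X s∈X)
  ...   | yes s∈X | there t∈ss = trans (occurrences-++ X (CS arc k (W - s) F) _) (cong₂ _+_
            (occurrences-CS-⊈ k (W - s) F λ X⊆W-s → x∉p-x W s (X⊆W-s s∈X))
            (loop-once k t∈W t∉X st ih ss (F ∪ ⁅ s ⁆) t∈ss (∪-⁅⁆-⊆ F⊆X s∈X)))
  ...   | no s∉X  | _           = trans (occurrences-++ X (CS arc k (W - s) F) _) (cong₂ _+_
            (ih s s∈W s∉X F⊆X)
            (occurrences-loop-frozen k W (F ∪ ⁅ s ⁆) ss s∈W (x∈p∪q⁺ (inj₂ (x∈⁅x⁆ s))) s∉X))
    where s∈W = deletable⇒∈ W F s eq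

  CS-counts-convex : Acyclic arc → ∀ k {W F X} → ∣ W ∣ ≤ k → Convex arc W X → F ⊆ X →
                     occurrences X (CS arc k W F) ≡ 1
  CS-counts-convex ac zero bd (X⊆W , (x , x∈X) , _) _ =
    ⊥-elim (n≮0 (<-≤-trans (x∈p⇒∣p-x∣<∣p∣ (X⊆W x∈X)) bd))
  CS-counts-convex ac (suc k) {W} {F} {X} bd cvx F⊆X with ⊆⇒≡⊎∃∉ (proj₁ cvx)
  ... | inj₁ refl = occurrences-CS-self (suc k) X F
  ... | inj₂ (v , v∈W , v∉X) with source-or-sink-outside ac cvx v∈W v∉X
  ... | t , t∈W , t∉X , st =
    trans (occurrences-∷-≢ {X = X} {W} (loop arc k W F (allFin n)) λ { refl → v∉X v∈W })
          (loop-once k t∈W t∉X st ih (allFin n) F (∈-allFin t) F⊆X)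
    where
      ih : ∀ {F'} s → s ∈ W → s ∉ X → F' ⊆ X → occurrences X (CS arc k (W - s) F') ≡ 1
      ih s s∈W s∉X = CS-counts-convex ac k (≤-pred (<-≤-trans (x∈p⇒∣p-x∣<∣p∣ s∈W) bd))
                                          (convex-delete cvx s∉X)

open Procedure

theorem11 : (n : ℕ) (D : Digraph n) → Acyclic D → (F X : Subset n) →
    Convex D ⊤ X → F ⊆ X → occurrences X (CS D n ⊤ F) ≡ 1
theorem11 n D ac F X cvx F⊆X = CS-counts-convex D ac n (∣p∣≤n ⊤) cvx F⊆X
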